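{- For all positive integers $k,m,n$, $R(B_{k,m},S_n)\leq k+m+n-1$.
   Context: For graphs $G_1,G_2$, $R(G_1,G_2)$ is the least integer $N$ such that every red/blue edge-coloring of $K_N$ contains a red copy of $G_1$ or a blue copy of $G_2$. $S_n$ denotes the star with $n$ edges ($n+1$ vertices: one center of degree $n$ and $n$ leaves). $B_{k,m}$ denotes the bistar on $k+m$ vertices: a vertex $v$ of degree $k$, a vertex $w$ adjacent to $v$ of degree $m$, and $k+m-2$ further vertices of degree $1$ (the edge $vw$ is its spine). -}

module Defs where

open import Data.Nat using (ℕ; zero; suc; _+_; _∸_; _≤_; _<_)
open import Data.Fin using (Fin; toℕ)
open import Data.Product using (Σ; ∃-syntax; _×_)
open import Data.Sum using (_⊎_)
open import Relation.Binary.PropositionalEquality using (_≡_)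
open import Function.Definitions using (Injective)

-- A graph on vertex set Fin v, given by an edge relation
-- (each edge is listed in at least one orientation).
Graph : ℕ → Set₁
Graph v = Fin v → Fin v → Set

data Colour : Set where
  red blue : Colour

-- A red/blue edge-colouring of K_N: a symmetric colour assignment to pairs
-- (values on the diagonal are irrelevant).
Colouring : ℕ → Set
Colouring N = Fin N → Fin N → Colour

IsEdgeColouring : {N : ℕ} → Colouring N → Set
IsEdgeColouring c = ∀ i j → c i j ≡ c j i

ContainsMono : {N v : ℕ} → Colouring N → Colour → Graph v → Set
ContainsMono {N} {v} c col G =
  ∃[ f ] (Injective _≡_ _≡_ f × (∀ (i j : Fin v) → G i j → c (f i) (f j) ≡ col))

RamseyProperty : {v₁ v₂ : ℕ} → Graph v₁ → Graph v₂ → ℕ → Set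
RamseyProperty G₁ G₂ N =
  (c : Colouring N) → IsEdgeColouring c → ContainsMono c red G₁ ⊎ ContainsMono c blue G₂

-- R(G₁,G₂) ≤ M : the least N with the Ramsey property is at most M,
-- i.e. some N ≤ M has the Ramsey property.
RamseyLE : {v₁ v₂ : ℕ} → Graph v₁ → Graph v₂ → ℕ → Set
RamseyLE G₁ G₂ M = ∃[ N ] (N ≤ M × RamseyProperty G₁ G₂ N)

-- Bistar B_{k,m} on vertices 0..k+m-1: vertex 0 = v, vertex 1 = w (spine 0-1),
-- leaves of v are 2..k, leaves of w are k+1..k+m-1.
data BistarEdgeℕ (k m : ℕ) : ℕ → ℕ → Set where
  spine : BistarEdgeℕ k m 0 1
  leftLeaf : ∀ {j} → 2 ≤ j → j ≤ k → BistarEdgeℕ k m 0 j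
  rightLeaf : ∀ {j} → suc k ≤ j → j < k + m → BistarEdgeℕ k m 1 j

Bistar : (k m : ℕ) → Graph (k + m)
Bistar k m i j = BistarEdgeℕ k m (toℕ i) (toℕ j)

data StarEdgeℕ (n : ℕ) : ℕ → ℕ → Set where
  ray : ∀ {j} → 1 ≤ j → j ≤ n → StarEdgeℕ n 0 j

Star : (n : ℕ) → Graph (suc n)
Star n i j = StarEdgeℕ n (toℕ i) (toℕ j)

module Submission where

-- Let N = k + m + n − 1 and colour K_N.  Call the blue neighbours of a vertex
-- x its "blue neighbourhood"; if some vertex has at least n of them we have a
-- blue S_n.  Otherwise every vertex has at most n − 1 blue neighbours, hence at
-- least k + m − 1 red ones.  Take any vertex v and a red neighbour w of v.
-- Choose k − 1 red neighbours A of v outside {v, w} (possible since at most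
-- 2 + (n − 1) vertices are excluded), and then m − 1 red neighbours B of w
-- outside {v, w} ∪ A (at most 2 + (k − 1) + (n − 1) excluded).  Then
-- v, w, A, B span a red B_{k,m} with spine vw.
--
-- Every edge used is read
-- as c x y from its centre x.

open import Defs
open import Data.Nat using (ℕ; zero; suc; _+_; _∸_; _≤_; _<_; z≤n; s≤s; _≤?_)
open import Data.Nat.Properties
  using (+-suc; +-monoˡ-≤; +-monoʳ-≤; +-cancelˡ-≤; ≤-trans; ≤-reflexive; ≤-refl;
         ≤-pred; ≰⇒>; <-≤-trans; m≤m+n; m≤n+m; m≤n⇒m⊓n≡m; +-commutativeSemigroup;
         module ≤-Reasoning)
open import Algebra.Properties.CommutativeSemigroup +-commutativeSemigroup using (xy∙z≈xz∙y)
open import Data.Nat.Tactic.RingSolver using (solve-∀)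
open import Data.Fin using (Fin; toℕ; fromℕ<)
open import Data.Fin.Properties using (toℕ<n; toℕ-injective) renaming (_≟_ to _≟ᶠ_)
open import Data.List using (List; []; _∷_; [_]; _++_; length; filter; take; allFin)
open import Data.List.Properties using (length-++; length-take; length-tabulate; take++drop≡id)
open import Data.List.Membership.Propositional using (_∈_; _∉_)
open import Data.List.Membership.Propositional.Properties
  using (∈-∃++; ∈-++⁺ˡ; ∈-++⁺ʳ; ∈-++⁻; ∈-filter⁺; ∈-filter⁻; ∈-allFin)
import Data.List.Membership.DecPropositional as DecMembership
open import Data.List.Relation.Binary.Subset.Propositional using (_⊆_)
open import Data.List.Relation.Unary.Any using (here; there)
import Data.List.Relation.Unary.All as All
open All using ([]; _∷_)
open import Data.List.Relation.Unary.AllPairs using ([]; _∷_)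
open import Data.List.Relation.Unary.Unique.Propositional using (Unique)
open import Data.List.Relation.Unary.Unique.Propositional.Properties
  using (++⁺; filter⁺; take⁺; allFin⁺)
open import Data.Product using (_,_; proj₁; proj₂; ∃-syntax; _×_)
open import Data.Sum using (_⊎_; inj₁; inj₂)
open import Data.Empty using (⊥-elim)
open import Relation.Nullary using (yes; no)
open import Relation.Unary using (Pred; Decidable)
open import Relation.Unary.Properties using (∁?)
open import Relation.Binary.Definitions using (DecidableEquality)
open import Relation.Binary.PropositionalEquality
  using (_≡_; _≢_; refl; sym; trans; cong; cong₂; subst; module ≡-Reasoning)
open import Function using (_∘_)

module _ {a} {A : Set a} where

  -- Pigeonhole principle for lists: a duplicate-free list contained in ys
  -- is no longer than ys.  Removing one copy of the head from ys leaves a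
  -- list still containing the tail.
  unique⊆⇒length≤ : {xs ys : List A} → Unique xs → xs ⊆ ys → length xs ≤ length ys
  unique⊆⇒length≤ [] _ = z≤n
  unique⊆⇒length≤ {x ∷ xs} (x≢xs ∷ xs-unique) xs⊆ys
    with ys₁ , ys₂ , refl ← ∈-∃++ (xs⊆ys (here refl)) = begin
      suc (length xs)                ≤⟨ s≤s (unique⊆⇒length≤ xs-unique xs⊆rest) ⟩
      suc (length (ys₁ ++ ys₂))      ≡⟨ cong suc (length-++ ys₁) ⟩
      suc (length ys₁ + length ys₂)  ≡⟨ sym (+-suc (length ys₁) (length ys₂)) ⟩
      length ys₁ + length (x ∷ ys₂)  ≡⟨ sym (length-++ ys₁) ⟩
      length (ys₁ ++ x ∷ ys₂)        ∎
    where
    open ≤-Reasoning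
    xs⊆rest : xs ⊆ ys₁ ++ ys₂
    xs⊆rest y∈xs with ∈-++⁻ ys₁ (xs⊆ys (there y∈xs))
    ... | inj₁ y∈ys₁         = ∈-++⁺ˡ y∈ys₁
    ... | inj₂ (here y≡x)    = ⊥-elim (All.lookup x≢xs y∈xs (sym y≡x))
    ... | inj₂ (there y∈ys₂) = ∈-++⁺ʳ ys₁ y∈ys₂

  length-filter-∁ : ∀ {p} {P : Pred A p} (P? : Decidable P) (xs : List A) →
                    length xs ≡ length (filter P? xs) + length (filter (∁? P?) xs)
  length-filter-∁ P? [] = refl
  length-filter-∁ P? (x ∷ xs) with P? x
  ... | yes _ = cong suc (length-filter-∁ P? xs)
  ... | no _  = trans (cong suc (length-filter-∁ P? xs))
                      (sym (+-suc (length (filter P? xs)) _))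

  ++-unique : {P S : List A} → Unique P → Unique S →
              (∀ {y} → y ∈ S → y ∉ P) → Unique (P ++ S)
  ++-unique P-unique S-unique S∌P = ++⁺ P-unique S-unique (λ (y∈P , y∈S) → S∌P y∈S y∈P)

  -- The i-th entry of a list, with fallback d outside its range; vertices of
  -- the graphs in Defs are indexed by ℕ, so embeddings are written with it.
  nth : A → List A → ℕ → A
  nth d []       _       = d
  nth d (x ∷ xs) zero    = x
  nth d (x ∷ xs) (suc i) = nth d xs i

  nth-∈ : ∀ {d xs i} → i < length xs → nth d xs i ∈ xs
  nth-∈ {xs = x ∷ xs} {zero}  _         = here refl
  nth-∈ {xs = x ∷ xs} {suc i} (s≤s i<n) = there (nth-∈ i<n)

  nth-++-∈ˡ : ∀ {d} P {S i} → i < length P → nth d (P ++ S) i ∈ P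
  nth-++-∈ˡ (p ∷ P) {i = zero}  _         = here refl
  nth-++-∈ˡ (p ∷ P) {i = suc i} (s≤s i<n) = there (nth-++-∈ˡ P i<n)

  nth-++-∈ʳ : ∀ {d} P {S i} → length P ≤ i → i < length P + length S → nth d (P ++ S) i ∈ S
  nth-++-∈ʳ []      _          i<n       = nth-∈ i<n
  nth-++-∈ʳ (p ∷ P) (s≤s P≤i) (s≤s i<n) = nth-++-∈ʳ P P≤i i<n

  nth-injective : ∀ {d xs i j} → Unique xs → i < length xs → j < length xs →
                  nth d xs i ≡ nth d xs j → i ≡ j
  nth-injective {i = zero}  {zero}  _ _ _ _ = refl
  nth-injective {i = zero}  {suc j} (x≢xs ∷ _) _ (s≤s j<n) x≡xⱼ =
    ⊥-elim (All.lookup x≢xs (nth-∈ j<n) x≡xⱼ)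
  nth-injective {i = suc i} {zero}  (x≢xs ∷ _) (s≤s i<n) _ xᵢ≡x =
    ⊥-elim (All.lookup x≢xs (nth-∈ i<n) (sym xᵢ≡x))
  nth-injective {i = suc i} {suc j} (_ ∷ xs-unique) (s≤s i<n) (s≤s j<n) xᵢ≡xⱼ =
    cong suc (nth-injective xs-unique i<n j<n xᵢ≡xⱼ)

module _ {a} {A : Set a} (_≟_ : DecidableEquality A) where
  open DecMembership _≟_ using (_∈?_; _∉?_)

  outside : List A → List A → List A
  outside B = filter (_∉? B)

  length-outside : ∀ B {U} → Unique U → length U ≤ length B + length (outside B U)
  length-outside B {U} U-unique = begin
    length U                                         ≡⟨ length-filter-∁ (_∈? B) U ⟩
    length (filter (_∈? B) U) + length (outside B U) ≤⟨ +-monoˡ-≤ _ inB≤B ⟩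
    length B + length (outside B U)                  ∎
    where
    open ≤-Reasoning
    inB≤B : length (filter (_∈? B) U) ≤ length B
    inB≤B = unique⊆⇒length≤ (filter⁺ (_∈? B) U-unique) (λ y∈ → proj₂ (∈-filter⁻ (_∈? B) {xs = U} y∈))

  outside-unique : ∀ B {U} → Unique U → Unique (outside B U)
  outside-unique B = filter⁺ (_∉? B)

  ∈-outside⁻ : ∀ B U {y} → y ∈ outside B U → y ∈ U × y ∉ B
  ∈-outside⁻ B U = ∈-filter⁻ (_∉? B) {xs = U}

  ∈-outside⁺ : ∀ B {U y} → y ∈ U → y ∉ B → y ∈ outside B U
  ∈-outside⁺ B = ∈-filter⁺ (_∉? B)

∈-take : ∀ {a} {A : Set a} {y : A} r xs → y ∈ take r xs → y ∈ xs
∈-take r xs y∈ = subst (_ ∈_) (take++drop≡id r xs) (∈-++⁺ˡ y∈)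

_≟ᶜ_ : DecidableEquality Colour
red  ≟ᶜ red  = yes refl
red  ≟ᶜ blue = no (λ ())
blue ≟ᶜ red  = no (λ ())
blue ≟ᶜ blue = yes refl

module InColouring {N : ℕ} (c : Colouring N) where

  vertices : List (Fin N)
  vertices = allFin N

  embed : ∀ {v} (E : ℕ → ℕ → Set) col d (L : List (Fin N)) →
          Unique L → v ≤ length L →
          (∀ {i j} → E i j → c (nth d L i) (nth d L j) ≡ col) →
          ContainsMono {v = v} c col (λ i j → E (toℕ i) (toℕ j))
  embed E col d L L-unique v≤L coloured =
    (λ i → nth d L (toℕ i)) ,
    (λ {i} {j} same → toℕ-injective (nth-injective L-unique (inRange i) (inRange j) same)) ,
    (λ i j → coloured)
    where
    inRange : ∀ i → toℕ i < length L
    inRange i = <-≤-trans (toℕ<n i) v≤L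

  others : Fin N → List (Fin N)
  others x = outside _≟ᶠ_ [ x ] vertices

  blue? : ∀ x → Decidable (λ y → c x y ≡ blue)
  blue? x y = c x y ≟ᶜ blue

  blueNbrs : Fin N → List (Fin N)
  blueNbrs x = filter (blue? x) (others x)

  blueNbrs-unique : ∀ x → Unique (blueNbrs x)
  blueNbrs-unique x = filter⁺ (blue? x) (outside-unique _≟ᶠ_ [ x ] (allFin⁺ N))

  blueNbrs-blue : ∀ {x y} → y ∈ blueNbrs x → c x y ≡ blue
  blueNbrs-blue {x} y∈ = proj₂ (∈-filter⁻ (blue? x) {xs = others x} y∈)

  blueNbrs-≢ : ∀ {x y} → y ∈ blueNbrs x → y ∉ [ x ]
  blueNbrs-≢ {x} y∈ = proj₂ (∈-outside⁻ _≟ᶠ_ [ x ] vertices (proj₁ (∈-filter⁻ (blue? x) {xs = others x} y∈)))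

  red-unless-blueNbr : ∀ {x y} → y ≢ x → y ∉ blueNbrs x → c x y ≡ red
  red-unless-blueNbr {x} {y} y≢x y∉ with c x y in cxy
  ... | red  = refl
  ... | blue = ⊥-elim (y∉ (∈-filter⁺ (blue? x) (∈-outside⁺ _≟ᶠ_ [ x ] (∈-allFin y) y∉[x]) cxy))
    where
    y∉[x] : y ∉ [ x ]
    y∉[x] (here y≡x) = y≢x y≡x

  blueStar : ∀ n x → n ≤ length (blueNbrs x) → ContainsMono c blue (Star n)
  blueStar n x n≤ =
    embed (StarEdgeℕ n) blue x ([ x ] ++ blueNbrs x)
          (++-unique ([] ∷ []) (blueNbrs-unique x) blueNbrs-≢) (s≤s n≤) rayBlue
    where
    rayBlue : ∀ {i j} → StarEdgeℕ n i j → c (nth x (x ∷ blueNbrs x) i) (nth x (x ∷ blueNbrs x) j) ≡ blue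
    rayBlue (ray {suc j} _ j<n) = blueNbrs-blue (nth-∈ (≤-trans j<n n≤))

  fewBlueNbrs⊎blueStar : ∀ n x → length (blueNbrs x) < n ⊎ ContainsMono c blue (Star n)
  fewBlueNbrs⊎blueStar n x with n ≤? length (blueNbrs x)
  ... | yes n≤ = inj₂ (blueStar n x n≤)
  ... | no  n≰ = inj₁ (≰⇒> n≰)

  freshRedNbrs : List (Fin N) → Fin N → ℕ → List (Fin N)
  freshRedNbrs P x r = take r (outside _≟ᶠ_ (P ++ blueNbrs x) vertices)

  module _ (P : List (Fin N)) (x : Fin N) (r : ℕ) where

    freshRedNbrs-unique : Unique (freshRedNbrs P x r)
    freshRedNbrs-unique = take⁺ r (outside-unique _≟ᶠ_ (P ++ blueNbrs x) (allFin⁺ N))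

    private
      avoids : ∀ {y} → y ∈ freshRedNbrs P x r → y ∉ P ++ blueNbrs x
      avoids y∈ = proj₂ (∈-outside⁻ _≟ᶠ_ (P ++ blueNbrs x) vertices (∈-take r _ y∈))

    freshRedNbrs-∉ : ∀ {y} → y ∈ freshRedNbrs P x r → y ∉ P
    freshRedNbrs-∉ y∈ y∈P = avoids y∈ (∈-++⁺ˡ y∈P)

    freshRedNbrs-red : x ∈ P → ∀ {y} → y ∈ freshRedNbrs P x r → c x y ≡ red
    freshRedNbrs-red x∈P y∈ =
      red-unless-blueNbr (λ { refl → freshRedNbrs-∉ y∈ x∈P })
                         (λ y∈Bl → avoids y∈ (∈-++⁺ʳ P y∈Bl))

    length-freshRedNbrs : length P + r + length (blueNbrs x) ≤ N → length (freshRedNbrs P x r) ≡ r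
    length-freshRedNbrs fits = trans (length-take r _) (m≤n⇒m⊓n≡m r≤)
      where
      open ≤-Reasoning
      excluded : List (Fin N)
      excluded = P ++ blueNbrs x
      r≤ : r ≤ length (outside _≟ᶠ_ excluded vertices)
      r≤ = +-cancelˡ-≤ (length excluded) r _ (begin
        length excluded + r                 ≡⟨ cong (_+ r) (length-++ P) ⟩
        length P + length (blueNbrs x) + r  ≡⟨ xy∙z≈xz∙y (length P) (length (blueNbrs x)) r ⟩
        length P + r + length (blueNbrs x)  ≤⟨ fits ⟩
        N                                   ≡⟨ sym (length-tabulate (λ y → y)) ⟩
        length vertices                     ≤⟨ length-outside _≟ᶠ_ excluded (allFin⁺ N) ⟩
        length excluded + length (outside _≟ᶠ_ excluded vertices) ∎)

  withBlueBound : ∀ {x n} p → length (blueNbrs x) ≤ n → p + n ≤ N → p + length (blueNbrs x) ≤ N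
  withBlueBound p few fits = ≤-trans (+-monoʳ-≤ p few) fits

  redNbr : ∀ v → 2 + length (blueNbrs v) ≤ N → ∃[ w ] (w ≢ v × c v w ≡ red)
  redNbr v fits = w , (λ w≡v → freshRedNbrs-∉ [ v ] v 1 w∈W (here w≡v)) , freshRedNbrs-red [ v ] v 1 (here refl) w∈W
    where
    W : List (Fin N)
    W = freshRedNbrs [ v ] v 1
    w : Fin N
    w = nth v W 0
    w∈W : w ∈ W
    w∈W = nth-∈ (subst (0 <_) (sym (length-freshRedNbrs [ v ] v 1 fits)) (s≤s z≤n))

  redBistar : ∀ k m n {v w} → 2 + k + m + n ≤ N → w ≢ v → c v w ≡ red →
              length (blueNbrs v) ≤ n → length (blueNbrs w) ≤ n →
              ContainsMono c red (Bistar (suc k) (suc m))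
  redBistar k m n {v} {w} fits w≢v vw-red few-v few-w =
    embed (BistarEdgeℕ (suc k) (suc m)) red v L L-unique (≤-reflexive (sym length-L)) edgeRed
    where
    vw A B L : List (Fin N)
    vw = v ∷ w ∷ []
    A = freshRedNbrs vw v k
    B = freshRedNbrs (vw ++ A) w m
    L = vw ++ A ++ B

    length-A : length A ≡ k
    length-A = length-freshRedNbrs vw v k
      (withBlueBound (2 + k) few-v (≤-trans (+-monoˡ-≤ n (m≤m+n (2 + k) m)) fits))

    length-B : length B ≡ m
    length-B = length-freshRedNbrs (vw ++ A) w m
      (withBlueBound (2 + length A + m) few-w (subst (λ a → 2 + a + m + n ≤ N) (sym length-A) fits))

    L-unique : Unique L
    L-unique = ++-unique (++-unique vw-unique (freshRedNbrs-unique vw v k) (freshRedNbrs-∉ vw v k))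
                         (freshRedNbrs-unique (vw ++ A) w m) (freshRedNbrs-∉ (vw ++ A) w m)
      where
      vw-unique : Unique vw
      vw-unique = (w≢v ∘ sym ∷ []) ∷ [] ∷ []

    length-L : length L ≡ suc k + suc m
    length-L = begin
      2 + length (A ++ B)         ≡⟨ cong (2 +_) (length-++ A) ⟩
      2 + (length A + length B)   ≡⟨ cong₂ (λ a b → 2 + (a + b)) length-A length-B ⟩
      2 + (k + m)                 ≡⟨ cong suc (sym (+-suc k m)) ⟩
      suc k + suc m               ∎
      where open ≡-Reasoning

    -- Leaf j ≥ 2 of v sits at position j − 2 of A ++ B, inside A; leaf j ≥ k + 1
    -- of w sits at position j − 2 ≥ k of A ++ B, inside B.
    edgeRed : ∀ {i j} → BistarEdgeℕ (suc k) (suc m) i j → c (nth v L i) (nth v L j) ≡ red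
    edgeRed spine = vw-red
    edgeRed (leftLeaf {suc (suc j)} (s≤s (s≤s z≤n)) (s≤s j<k)) =
      freshRedNbrs-red vw v k (here refl) (nth-++-∈ˡ A (subst (j <_) (sym length-A) j<k))
    edgeRed (rightLeaf {suc (suc j)} (s≤s (s≤s k≤j)) (s≤s j+2≤k+1+m)) =
      freshRedNbrs-red (vw ++ A) w m (there (here refl))
        (nth-++-∈ʳ A (subst (_≤ j) (sym length-A) k≤j)
          (subst (suc j ≤_) (cong₂ _+_ (sym length-A) (sym length-B))
            (≤-pred (≤-trans j+2≤k+1+m (≤-reflexive (+-suc k m))))))

  redBistar⊎blueStar : ∀ k m n → 2 + k + m + n ≤ N → Fin N →
                       ContainsMono c red (Bistar (suc k) (suc m)) ⊎ ContainsMono c blue (Star (suc n))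
  redBistar⊎blueStar k m n fits = fromVertex
    where
    twoFit : 2 + n ≤ N
    twoFit = ≤-trans (+-monoˡ-≤ n (≤-trans (m≤m+n 2 k) (m≤m+n (2 + k) m))) fits

    fromVertex : Fin N → ContainsMono c red (Bistar (suc k) (suc m)) ⊎ ContainsMono c blue (Star (suc n))
    fromVertex v with fewBlueNbrs⊎blueStar (suc n) v
    ... | inj₂ star = inj₂ star
    ... | inj₁ few-v
      with w , w≢v , vw-red ← redNbr v (withBlueBound 2 (≤-pred few-v) twoFit)
      with fewBlueNbrs⊎blueStar (suc n) w
    ...   | inj₂ star  = inj₂ star
    ...   | inj₁ few-w = inj₁ (redBistar k m n fits w≢v vw-red (≤-pred few-v) (≤-pred few-w))

theorem2 : (k m n : ℕ) → 1 ≤ k → 1 ≤ m → 1 ≤ n →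
    RamseyLE (Bistar k m) (Star n) (k + m + n ∸ 1)
theorem2 (suc k) (suc m) (suc n) _ _ _ =
  N , ≤-refl , λ c _ → InColouring.redBistar⊎blueStar c k m n fits someVertex
  where
  N : ℕ
  N = k + suc m + suc n
  fits : 2 + k + m + n ≤ N
  fits = ≤-reflexive (count k m n)
    where
    count : ∀ k m n → 2 + k + m + n ≡ k + suc m + suc n
    count = solve-∀
  someVertex : Fin N
  someVertex = fromℕ< {0} (≤-trans (s≤s z≤n) (m≤n+m (suc n) (k + suc m)))
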